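{- Let $x,y$ be complex numbers with $x\neq 0$, $y\neq 0$, $x^2+4y\neq 0$. For every nonnegative integer $n$, $$(n+1)\sum_{k=0}^{\lfloor (n-1)/2\rfloor}\binom{n}{2k+1}\frac{(x^2+4y)^{k+1}x^{n-2k-1}}{k+1}=2^{n+1}L_{n+1}(x,y)-2x^{n+1}.$$
   Context: The bivariate Lucas polynomials are defined by $L_0(x,y)=2$, $L_1(x,y)=x$ and $L_n(x,y)=xL_{n-1}(x,y)+yL_{n-2}(x,y)$ for $n\ge 2$. An empty sum equals $0$. -}

module Defs where

open import Level using (Level)
open import Algebra.Bundles using (CommutativeRing)
open import Data.Nat.Base using (ℕ; zero; suc)

-- Generic operations in a commutative ring R (used to instantiate the
-- complex-number statement).
module _ {c ℓ : Level} (R : CommutativeRing c ℓ) where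
  open CommutativeRing R using (Carrier; 0#; 1#; _+_; _*_)

  natR : ℕ → Carrier
  natR zero    = 0#
  natR (suc n) = 1# + natR n

  powR : Carrier → ℕ → Carrier
  powR a zero    = 1#
  powR a (suc n) = a * powR a n

  lucas : Carrier → Carrier → ℕ → Carrier
  lucas x y zero          = natR 2
  lucas x y (suc zero)    = x
  lucas x y (suc (suc n)) = x * lucas x y (suc n) + y * lucas x y n

  sumR : ℕ → (ℕ → Carrier) → Carrier
  sumR zero    f = 0#
  sumR (suc m) f = f zero + sumR m (λ k → f (suc k))

{-# OPTIONS --safe #-}
module Submission where

open import Defs
open import Algebra.Bundles using (CommutativeRing)
open import Data.Nat.Base using (ℕ; zero; suc; _∸_; _<_; _≤_; z≤n; s≤s; ⌊_/2⌋)
  renaming (_+_ to _+ℕ_; _*_ to _*ℕ_)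
open import Data.Nat.Combinatorics using (_C_; nC1≡n; k>n⇒nCk≡0; nCk+nC[k+1]≡[n+1]C[k+1])
import Data.Nat.Properties as ℕ
import Relation.Binary.PropositionalEquality as ≡
open ≡ using (_≡_)
open import Relation.Nullary using (¬_; yes; no)

-- With D = x² + 4y one has 2ⁿ Lₙ = (x + √D)ⁿ + (x − √D)ⁿ = 2 Eₙ, where Eₙ = Σⱼ C(n,2j) xⁿ⁻²ʲ Dʲ.
-- The square root is avoided by pairing Eₙ with the odd part Oₙ = Σⱼ C(n,2j+1) xⁿ⁻²ʲ⁻¹ Dʲ: Pascal's
-- rule gives Eₙ₊₁ = x Eₙ + D Oₙ and Oₙ₊₁ = Eₙ + x Oₙ, hence Eₙ₊₂ = 2x Eₙ₊₁ + 4y Eₙ, the recurrence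
-- of 2ⁿ Lₙ. The absorption identity (n+1) C(n,2k+1) = (2k+2) C(n+1,2k+2) turns the left-hand side
-- into 2 (Eₙ₊₁ − xⁿ⁺¹).

[1+k]*[1+n]C[1+k]≡[1+n]*nCk : ∀ n k → suc k *ℕ (suc n C suc k) ≡ suc n *ℕ (n C k)
[1+k]*[1+n]C[1+k]≡[1+n]*nCk zero    zero    = ≡.refl
[1+k]*[1+n]C[1+k]≡[1+n]*nCk zero    (suc k) = ℕ.*-zeroʳ (suc (suc k))
[1+k]*[1+n]C[1+k]≡[1+n]*nCk (suc n) zero    = begin
  suc (suc n) C 1 +ℕ 0  ≡⟨ ℕ.+-identityʳ _ ⟩
  suc (suc n) C 1       ≡⟨ nC1≡n (suc (suc n)) ⟩
  suc (suc n)           ≡⟨ ℕ.*-identityʳ (suc (suc n)) ⟨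
  suc (suc n) *ℕ 1      ∎
  where open ≡.≡-Reasoning
[1+k]*[1+n]C[1+k]≡[1+n]*nCk (suc n) (suc k) = begin
  suc (suc k) *ℕ (suc (suc n) C suc (suc k))     ≡⟨ ≡.cong (suc (suc k) *ℕ_) (nCk+nC[k+1]≡[n+1]C[k+1] (suc n) (suc k)) ⟨
  suc (suc k) *ℕ (a +ℕ b)                       ≡⟨ ℕ.*-distribˡ-+ (suc (suc k)) a b ⟩
  (a +ℕ suc k *ℕ a) +ℕ suc (suc k) *ℕ b         ≡⟨ ≡.cong₂ (λ u v → (a +ℕ u) +ℕ v)
                                                     ([1+k]*[1+n]C[1+k]≡[1+n]*nCk n k)
                                                     ([1+k]*[1+n]C[1+k]≡[1+n]*nCk n (suc k)) ⟩
  (a +ℕ suc n *ℕ (n C k)) +ℕ suc n *ℕ (n C suc k) ≡⟨ ℕ.+-assoc a _ _ ⟩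
  a +ℕ (suc n *ℕ (n C k) +ℕ suc n *ℕ (n C suc k)) ≡⟨ ≡.cong (a +ℕ_) (ℕ.*-distribˡ-+ (suc n) (n C k) (n C suc k)) ⟨
  a +ℕ suc n *ℕ (n C k +ℕ n C suc k)             ≡⟨ ≡.cong (λ m → a +ℕ suc n *ℕ m) (nCk+nC[k+1]≡[n+1]C[k+1] n k) ⟩
  suc (suc n) *ℕ a                              ∎
  where
  open ≡.≡-Reasoning
  a = suc n C suc k
  b = suc n C suc (suc k)

n<2*[1+⌊n/2⌋] : ∀ n → n < 2 *ℕ suc ⌊ n /2⌋
n<2*[1+⌊n/2⌋] zero             = s≤s z≤n
n<2*[1+⌊n/2⌋] (suc zero)       = s≤s (s≤s z≤n)
n<2*[1+⌊n/2⌋] (suc (suc n))    =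
  ≡.subst (suc (suc n) <_) (≡.sym (ℕ.*-suc 2 (suc ⌊ n /2⌋))) (s≤s (s≤s (n<2*[1+⌊n/2⌋] n)))

module _ {r ℓ} (R : CommutativeRing r ℓ) where
  open CommutativeRing R
  open import Algebra.Properties.Semiring.Mult semiring using (_×_; ×-homo-+; ×1-homo-*)
  open import Algebra.Properties.CommutativeSemigroup *-commutativeSemigroup using (x∙yz≈y∙xz)
  open import Algebra.Solver.Ring.NaturalCoefficients.Default commutativeSemiring
    using (solve; _:+_; _:*_; _:=_)
  open import Relation.Binary.Reasoning.Setoid setoid

  natR≈×1# : ∀ n → natR R n ≈ n × 1#
  natR≈×1# zero    = refl
  natR≈×1# (suc n) = +-congˡ (natR≈×1# n)

  natR-+ : ∀ m n → natR R (m +ℕ n) ≈ natR R m + natR R n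
  natR-+ m n = begin
    natR R (m +ℕ n)         ≈⟨ natR≈×1# (m +ℕ n) ⟩
    (m +ℕ n) × 1#           ≈⟨ ×-homo-+ 1# m n ⟩
    m × 1# + n × 1#         ≈⟨ +-cong (natR≈×1# m) (natR≈×1# n) ⟨
    natR R m + natR R n     ∎

  natR-* : ∀ m n → natR R (m *ℕ n) ≈ natR R m * natR R n
  natR-* m n = begin
    natR R (m *ℕ n)         ≈⟨ natR≈×1# (m *ℕ n) ⟩
    (m *ℕ n) × 1#           ≈⟨ ×1-homo-* m n ⟩
    (m × 1#) * (n × 1#)     ≈⟨ *-cong (natR≈×1# m) (natR≈×1# n) ⟨
    natR R m * natR R n     ∎

  natR-cong : ∀ {m n} → m ≡ n → natR R m ≈ natR R n
  natR-cong ≡.refl = refl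

  natR-absorption : ∀ n j → natR R (suc n) * natR R (n C j) ≈ natR R (suc j) * natR R (suc n C suc j)
  natR-absorption n j = begin
    natR R (suc n) * natR R (n C j)          ≈⟨ natR-* (suc n) (n C j) ⟨
    natR R (suc n *ℕ (n C j))                ≈⟨ natR-cong ([1+k]*[1+n]C[1+k]≡[1+n]*nCk n j) ⟨
    natR R (suc j *ℕ (suc n C suc j))        ≈⟨ natR-* (suc j) (suc n C suc j) ⟩
    natR R (suc j) * natR R (suc n C suc j)  ∎

  natR-2*≈+ : ∀ z → natR R 2 * z ≈ z + z
  natR-2*≈+ z = begin
    (1# + (1# + 0#)) * z    ≈⟨ *-congʳ (+-congˡ (+-identityʳ 1#)) ⟩
    (1# + 1#) * z           ≈⟨ distribʳ z 1# 1# ⟩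
    1# * z + 1# * z         ≈⟨ +-cong (*-identityˡ z) (*-identityˡ z) ⟩
    z + z                   ∎

  sumR-cong : ∀ m {f g : ℕ → Carrier} → (∀ k → f k ≈ g k) → sumR R m f ≈ sumR R m g
  sumR-cong zero    f≈g = refl
  sumR-cong (suc m) f≈g = +-cong (f≈g 0) (sumR-cong m (λ k → f≈g (suc k)))

  sumR-+ : ∀ m (f g : ℕ → Carrier) → sumR R m (λ k → f k + g k) ≈ sumR R m f + sumR R m g
  sumR-+ zero    f g = sym (+-identityʳ 0#)
  sumR-+ (suc m) f g = begin
    (f 0 + g 0) + sumR R m (λ k → f (suc k) + g (suc k))
      ≈⟨ +-congˡ (sumR-+ m (λ k → f (suc k)) (λ k → g (suc k))) ⟩
    (f 0 + g 0) + (sumR R m (λ k → f (suc k)) + sumR R m (λ k → g (suc k)))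
      ≈⟨ solve 4 (λ a b c d → (a :+ b) :+ (c :+ d) := (a :+ c) :+ (b :+ d)) refl (f 0) (g 0) _ _ ⟩
    (f 0 + sumR R m (λ k → f (suc k))) + (g 0 + sumR R m (λ k → g (suc k)))
      ∎

  *-distribˡ-sumR : ∀ m a (f : ℕ → Carrier) → a * sumR R m f ≈ sumR R m (λ k → a * f k)
  *-distribˡ-sumR zero    a f = zeroʳ a
  *-distribˡ-sumR (suc m) a f = trans (distribˡ a _ _) (+-congˡ (*-distribˡ-sumR m a (λ k → f (suc k))))

  sumR-zero : ∀ m (f : ℕ → Carrier) → (∀ k → f k ≈ 0#) → sumR R m f ≈ 0#
  sumR-zero zero    f f≈0 = refl
  sumR-zero (suc m) f f≈0 =
    trans (+-cong (f≈0 0) (sumR-zero m (λ k → f (suc k)) (λ k → f≈0 (suc k)))) (+-identityʳ 0#)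

  sumR-vanishing-tail : ∀ {m m′} (f : ℕ → Carrier) → m ≤ m′ → (∀ k → m ≤ k → f k ≈ 0#) →
    sumR R m′ f ≈ sumR R m f
  sumR-vanishing-tail {m′ = m′} f z≤n     f≈0 = sumR-zero m′ f (λ k → f≈0 k z≤n)
  sumR-vanishing-tail           f (s≤s p) f≈0 =
    +-congˡ (sumR-vanishing-tail (λ k → f (suc k)) p (λ k q → f≈0 (suc k) (s≤s q)))

  recurrence₂-unique : ∀ (a b : Carrier) (u v : ℕ → Carrier) →
    (∀ n → u (suc (suc n)) ≈ a * u (suc n) + b * u n) →
    (∀ n → v (suc (suc n)) ≈ a * v (suc n) + b * v n) →
    u 0 ≈ v 0 → u 1 ≈ v 1 → ∀ n → u n ≈ v n
  recurrence₂-unique a b u v u-rec v-rec u₀≈v₀ u₁≈v₁ = go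
    where
    go : ∀ n → u n ≈ v n
    go zero          = u₀≈v₀
    go (suc zero)    = u₁≈v₁
    go (suc (suc n)) = begin
      u (suc (suc n))               ≈⟨ u-rec n ⟩
      a * u (suc n) + b * u n       ≈⟨ +-cong (*-congˡ (go (suc n))) (*-congˡ (go n)) ⟩
      a * v (suc n) + b * v n       ≈⟨ v-rec n ⟨
      v (suc (suc n))               ∎

  module _ (x D : Carrier) where

    binomialTerm : ℕ → ℕ → Carrier
    binomialTerm n j = natR R (n C j) * powR R x (n ∸ j)

    binomialTerm-vanish : ∀ n j → n < j → binomialTerm n j ≈ 0#
    binomialTerm-vanish n j n<j = trans (*-congʳ (natR-cong (k>n⇒nCk≡0 n<j))) (zeroˡ _)

    binomialTerm-zero : ∀ n → binomialTerm n 0 ≈ powR R x n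
    binomialTerm-zero n = trans (*-congʳ (+-identityʳ 1#)) (*-identityˡ _)

    -- x ^ (n ∸ j) ≈ x * x ^ (n ∸ suc j) fails (∸ truncates) exactly when n ≤ j, where n C suc j ≡ 0.
    *-binomialTerm-suc : ∀ n j → x * binomialTerm n (suc j) ≈ natR R (n C suc j) * powR R x (n ∸ j)
    *-binomialTerm-suc n j with suc j ℕ.≤? n
    ... | yes j<n = begin
      x * (natR R (n C suc j) * powR R x (n ∸ suc j))   ≈⟨ x∙yz≈y∙xz x _ _ ⟩
      natR R (n C suc j) * powR R x (suc (n ∸ suc j))   ≡⟨ ≡.cong (λ m → natR R (n C suc j) * powR R x m) (ℕ.+-∸-assoc 1 j<n) ⟨
      natR R (n C suc j) * powR R x (n ∸ j)             ∎
    ... | no  j≮n = begin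
      x * (natR R (n C suc j) * powR R x (n ∸ suc j))   ≈⟨ *-congˡ (binomialTerm-vanish n (suc j) (ℕ.≰⇒> j≮n)) ⟩
      x * 0#                                            ≈⟨ zeroʳ x ⟩
      0#                                                ≈⟨ zeroˡ _ ⟨
      0# * powR R x (n ∸ j)                             ≈⟨ *-congʳ (natR-cong (k>n⇒nCk≡0 (ℕ.≰⇒> j≮n))) ⟨
      natR R (n C suc j) * powR R x (n ∸ j)             ∎

    binomialTerm-pascal : ∀ n j → binomialTerm (suc n) (suc j) ≈ binomialTerm n j + x * binomialTerm n (suc j)
    binomialTerm-pascal n j = begin
      natR R (suc n C suc j) * powR R x (n ∸ j)
        ≈⟨ *-congʳ (natR-cong (nCk+nC[k+1]≡[n+1]C[k+1] n j)) ⟨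
      natR R (n C j +ℕ n C suc j) * powR R x (n ∸ j)
        ≈⟨ trans (*-congʳ (natR-+ (n C j) (n C suc j))) (distribʳ _ _ _) ⟩
      binomialTerm n j + natR R (n C suc j) * powR R x (n ∸ j)
        ≈⟨ +-congˡ (*-binomialTerm-suc n j) ⟨
      binomialTerm n j + x * binomialTerm n (suc j)
        ∎

    evenTerm oddTerm : ℕ → ℕ → Carrier
    evenTerm n j = binomialTerm n (2 *ℕ j) * powR R D j
    oddTerm  n j = binomialTerm n (suc (2 *ℕ j)) * powR R D j

    evenSum oddSum : ℕ → Carrier
    evenSum n = sumR R (suc n) (evenTerm n)
    oddSum  n = sumR R (suc n) (oddTerm n)

    evenTerm-vanish : ∀ n j → n < 2 *ℕ j → evenTerm n j ≈ 0#
    evenTerm-vanish n j n<2j = trans (*-congʳ (binomialTerm-vanish n (2 *ℕ j) n<2j)) (zeroˡ _)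

    oddTerm-vanish : ∀ n j → n < suc (2 *ℕ j) → oddTerm n j ≈ 0#
    oddTerm-vanish n j n<2j+1 = trans (*-congʳ (binomialTerm-vanish n (suc (2 *ℕ j)) n<2j+1)) (zeroˡ _)

    evenTerm-zero : ∀ n → evenTerm n 0 ≈ powR R x n
    evenTerm-zero n = trans (*-identityʳ _) (binomialTerm-zero n)

    evenTerm-pascal : ∀ n j → evenTerm (suc n) (suc j) ≈ D * oddTerm n j + x * evenTerm n (suc j)
    evenTerm-pascal n j = begin
      binomialTerm (suc n) (2 *ℕ suc j) * (D * powR R D j)
        ≡⟨ ≡.cong (λ i → binomialTerm (suc n) i * (D * powR R D j)) (ℕ.*-suc 2 j) ⟩
      binomialTerm (suc n) (suc (suc (2 *ℕ j))) * (D * powR R D j)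
        ≈⟨ *-congʳ (binomialTerm-pascal n (suc (2 *ℕ j))) ⟩
      (binomialTerm n (suc (2 *ℕ j)) + x * binomialTerm n (suc (suc (2 *ℕ j)))) * (D * powR R D j)
        ≡⟨ ≡.cong (λ i → (binomialTerm n (suc (2 *ℕ j)) + x * binomialTerm n i) * (D * powR R D j)) (ℕ.*-suc 2 j) ⟨
      (binomialTerm n (suc (2 *ℕ j)) + x * binomialTerm n (2 *ℕ suc j)) * (D * powR R D j)
        ≈⟨ solve 5 (λ b x b′ D p → (b :+ x :* b′) :* (D :* p) := D :* (b :* p) :+ x :* (b′ :* (D :* p)))
                   refl (binomialTerm n (suc (2 *ℕ j))) x (binomialTerm n (2 *ℕ suc j)) D (powR R D j) ⟩
      D * oddTerm n j + x * evenTerm n (suc j)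
        ∎

    oddTerm-pascal : ∀ n j → oddTerm (suc n) j ≈ evenTerm n j + x * oddTerm n j
    oddTerm-pascal n j = trans (*-congʳ (binomialTerm-pascal n (2 *ℕ j)))
      (solve 4 (λ b x b′ p → (b :+ x :* b′) :* p := b :* p :+ x :* (b′ :* p))
             refl (binomialTerm n (2 *ℕ j)) x (binomialTerm n (suc (2 *ℕ j))) (powR R D j))

    evenSum-zero : evenSum 0 ≈ 1#
    evenSum-zero = trans (+-identityʳ _) (evenTerm-zero 0)

    evenSum-one : evenSum 1 ≈ x
    evenSum-one = begin
      evenTerm 1 0 + (evenTerm 1 1 + 0#)   ≈⟨ +-cong (evenTerm-zero 1) (trans (+-identityʳ _) (evenTerm-vanish 1 1 (s≤s (s≤s z≤n)))) ⟩
      x * 1# + 0#                          ≈⟨ trans (+-identityʳ _) (*-identityʳ x) ⟩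
      x                                    ∎

    evenSum-split : ∀ n → evenSum n ≈ powR R x n + sumR R n (λ j → evenTerm n (suc j))
    evenSum-split n = +-congʳ (evenTerm-zero n)

    oddSum-suc : ∀ n → oddSum (suc n) ≈ evenSum n + x * oddSum n
    oddSum-suc n = begin
      sumR R (suc (suc n)) (oddTerm (suc n))
        ≈⟨ sumR-cong (suc (suc n)) (oddTerm-pascal n) ⟩
      sumR R (suc (suc n)) (λ j → evenTerm n j + x * oddTerm n j)
        ≈⟨ sumR-+ (suc (suc n)) (evenTerm n) (λ j → x * oddTerm n j) ⟩
      sumR R (suc (suc n)) (evenTerm n) + sumR R (suc (suc n)) (λ j → x * oddTerm n j)
        ≈⟨ +-congʳ (sumR-vanishing-tail (evenTerm n) (ℕ.n≤1+n (suc n)) (λ k n<k → evenTerm-vanish n k (n<k⇒n<2*k n<k))) ⟩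
      evenSum n + sumR R (suc (suc n)) (λ j → x * oddTerm n j)
        ≈⟨ +-congˡ (*-distribˡ-sumR (suc (suc n)) x (oddTerm n)) ⟨
      evenSum n + x * sumR R (suc (suc n)) (oddTerm n)
        ≈⟨ +-congˡ (*-congˡ (sumR-vanishing-tail (oddTerm n) (ℕ.n≤1+n (suc n))
                              (λ k n<k → oddTerm-vanish n k (ℕ.m<n⇒m<1+n (n<k⇒n<2*k n<k))))) ⟩
      evenSum n + x * oddSum n
        ∎
      where
      n<k⇒n<2*k : ∀ {k} → n < k → n < 2 *ℕ k
      n<k⇒n<2*k {k} n<k = ℕ.<-≤-trans n<k (ℕ.m≤n*m k 2)

    evenSum-suc : ∀ n → evenSum (suc n) ≈ x * evenSum n + D * oddSum n
    evenSum-suc n = begin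
      evenTerm (suc n) 0 + sumR R (suc n) (λ j → evenTerm (suc n) (suc j))
        ≈⟨ +-cong (evenTerm-zero (suc n)) (sumR-cong (suc n) (evenTerm-pascal n)) ⟩
      x * powR R x n + sumR R (suc n) (λ j → D * oddTerm n j + x * evenTerm n (suc j))
        ≈⟨ +-cong (*-congˡ (evenTerm-zero n)) (sym (sumR-+ (suc n) (λ j → D * oddTerm n j) (λ j → x * evenTerm n (suc j)))) ⟨
      x * evenTerm n 0 + (sumR R (suc n) (λ j → D * oddTerm n j) + sumR R (suc n) (λ j → x * evenTerm n (suc j)))
        ≈⟨ +-congˡ (+-cong (*-distribˡ-sumR (suc n) D (oddTerm n)) (*-distribˡ-sumR (suc n) x (λ j → evenTerm n (suc j)))) ⟨
      x * evenTerm n 0 + (D * oddSum n + x * sumR R (suc n) (λ j → evenTerm n (suc j)))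
        ≈⟨ +-congˡ (+-congˡ (*-congˡ (sumR-vanishing-tail (λ j → evenTerm n (suc j)) (ℕ.n≤1+n n)
                                        (λ k n≤k → evenTerm-vanish n (suc k) (ℕ.<-≤-trans (s≤s n≤k) (ℕ.m≤n*m (suc k) 2)))))) ⟩
      x * evenTerm n 0 + (D * oddSum n + x * sumR R n (λ j → evenTerm n (suc j)))
        ≈⟨ solve 4 (λ x e o t → x :* e :+ (o :+ x :* t) := x :* (e :+ t) :+ o) refl x (evenTerm n 0) (D * oddSum n) _ ⟩
      x * evenSum n + D * oddSum n
        ∎

    evenSum-rec₂ : ∀ a → D ≈ x * x + a → ∀ n →
                   evenSum (suc (suc n)) ≈ (x + x) * evenSum (suc n) + a * evenSum n
    evenSum-rec₂ a D≈x²+a n = begin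
      evenSum (suc (suc n))
        ≈⟨ evenSum-suc (suc n) ⟩
      x * evenSum (suc n) + D * oddSum (suc n)
        ≈⟨ +-congˡ (*-congˡ (oddSum-suc n)) ⟩
      x * evenSum (suc n) + D * (evenSum n + x * oddSum n)
        ≈⟨ +-congˡ (solve 4 (λ D e x o → D :* (e :+ x :* o) := D :* e :+ x :* (D :* o)) refl D (evenSum n) x (oddSum n)) ⟩
      x * evenSum (suc n) + (D * evenSum n + x * (D * oddSum n))
        ≈⟨ +-congˡ (+-congʳ (*-congʳ D≈x²+a)) ⟩
      x * evenSum (suc n) + ((x * x + a) * evenSum n + x * (D * oddSum n))
        ≈⟨ solve 5 (λ x e₁ a e₀ o → x :* e₁ :+ ((x :* x :+ a) :* e₀ :+ x :* o)
                                    := x :* e₁ :+ x :* (x :* e₀ :+ o) :+ a :* e₀)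
                   refl x (evenSum (suc n)) a (evenSum n) (D * oddSum n) ⟩
      x * evenSum (suc n) + x * (x * evenSum n + D * oddSum n) + a * evenSum n
        ≈⟨ +-congʳ (+-congˡ (*-congˡ (evenSum-suc n))) ⟨
      x * evenSum (suc n) + x * evenSum (suc n) + a * evenSum n
        ≈⟨ +-congʳ (distribʳ (evenSum (suc n)) x x) ⟨
      (x + x) * evenSum (suc n) + a * evenSum n
        ∎

    [1+n]*oddSummand≈2*evenTerm : ∀ n k (i : Carrier) → natR R (suc k) * i ≈ 1# →
      natR R (suc n) * (natR R (n C (2 *ℕ k +ℕ 1)) * powR R D (suc k) * powR R x (n ∸ (2 *ℕ k +ℕ 1)) * i)
        ≈ natR R 2 * evenTerm (suc n) (suc k)
    [1+n]*oddSummand≈2*evenTerm n k i [1+k]*i≈1 = begin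
      natR R (suc n) * (natR R (n C j) * Dᵏ⁺¹ * xⁿ⁻ʲ * i)
        ≈⟨ solve 5 (λ a b d p i → a :* (b :* d :* p :* i) := (a :* b) :* (d :* p :* i)) refl _ _ Dᵏ⁺¹ xⁿ⁻ʲ i ⟩
      (natR R (suc n) * natR R (n C j)) * (Dᵏ⁺¹ * xⁿ⁻ʲ * i)
        ≈⟨ *-congʳ (natR-absorption n j) ⟩
      (natR R (suc j) * natR R (suc n C suc j)) * (Dᵏ⁺¹ * xⁿ⁻ʲ * i)
        ≈⟨ *-congʳ (*-congʳ (trans (natR-cong [1+j]≡2*[1+k]) (natR-* 2 (suc k)))) ⟩
      (natR R 2 * natR R (suc k) * natR R (suc n C suc j)) * (Dᵏ⁺¹ * xⁿ⁻ʲ * i)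
        ≈⟨ solve 6 (λ t s b d p i → (t :* s :* b) :* (d :* p :* i) := t :* (b :* p) :* d :* (s :* i))
                   refl (natR R 2) _ _ Dᵏ⁺¹ xⁿ⁻ʲ i ⟩
      natR R 2 * binomialTerm (suc n) (suc j) * Dᵏ⁺¹ * (natR R (suc k) * i)
        ≈⟨ trans (*-congˡ [1+k]*i≈1) (*-identityʳ _) ⟩
      natR R 2 * binomialTerm (suc n) (suc j) * Dᵏ⁺¹
        ≡⟨ ≡.cong (λ m → natR R 2 * binomialTerm (suc n) m * Dᵏ⁺¹) [1+j]≡2*[1+k] ⟩
      natR R 2 * binomialTerm (suc n) (2 *ℕ suc k) * Dᵏ⁺¹
        ≈⟨ *-assoc _ _ _ ⟩
      natR R 2 * evenTerm (suc n) (suc k)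
        ∎
      where
      j = 2 *ℕ k +ℕ 1
      Dᵏ⁺¹ = powR R D (suc k)
      xⁿ⁻ʲ = powR R x (n ∸ j)
      [1+j]≡2*[1+k] : suc j ≡ 2 *ℕ suc k
      [1+j]≡2*[1+k] = ≡.trans (≡.cong suc (ℕ.+-comm (2 *ℕ k) 1)) (≡.sym (ℕ.*-suc 2 k))

  scaledLucas-rec : ∀ x y n →
    powR R (natR R 2) (suc (suc n)) * lucas R x y (suc (suc n))
      ≈ (x + x) * (powR R (natR R 2) (suc n) * lucas R x y (suc n))
        + natR R 4 * y * (powR R (natR R 2) n * lucas R x y n)
  scaledLucas-rec x y n = begin
    t * (t * p) * (x * L₁ + y * L₀)
      ≈⟨ solve 6 (λ t p x y L₁ L₀ → t :* (t :* p) :* (x :* L₁ :+ y :* L₀)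
                                   := t :* (x :* (t :* p :* L₁)) :+ t :* t :* y :* (p :* L₀))
                 refl t p x y L₁ L₀ ⟩
    t * (x * (t * p * L₁)) + t * t * y * (p * L₀)
      ≈⟨ +-cong (natR-2*≈+ _) (*-congʳ (*-congʳ (sym (natR-* 2 2)))) ⟩
    x * (t * p * L₁) + x * (t * p * L₁) + natR R 4 * y * (p * L₀)
      ≈⟨ +-congʳ (distribʳ _ x x) ⟨
    (x + x) * (t * p * L₁) + natR R 4 * y * (p * L₀)
      ∎
    where
    t = natR R 2
    p = powR R t n
    L₁ = lucas R x y (suc n)
    L₀ = lucas R x y n

  scaledLucas≈2*evenSum : ∀ x y n →
    powR R (natR R 2) n * lucas R x y n ≈ natR R 2 * evenSum x (x * x + natR R 4 * y) n
  scaledLucas≈2*evenSum x y = recurrence₂-unique (x + x) c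
    (λ n → powR R t n * lucas R x y n) (λ n → t * E n)
    (scaledLucas-rec x y) 2*E-rec
    (trans (*-identityˡ t) (sym (trans (*-congˡ (evenSum-zero x D)) (*-identityʳ t))))
    (trans (*-congʳ (*-identityʳ t)) (*-congˡ (sym (evenSum-one x D))))
    where
    t = natR R 2
    c = natR R 4 * y
    D = x * x + c
    E = evenSum x D
    2*E-rec : ∀ n → t * E (suc (suc n)) ≈ (x + x) * (t * E (suc n)) + c * (t * E n)
    2*E-rec n = trans (*-congˡ (evenSum-rec₂ x D c refl n))
      (solve 5 (λ t a e₁ c e₀ → t :* (a :* e₁ :+ c :* e₀) := a :* (t :* e₁) :+ c :* (t :* e₀))
             refl t (x + x) (E (suc n)) c (E n))

mainTheorem3 : ∀ {c ℓ} (R : CommutativeRing c ℓ) →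
    let open CommutativeRing R in
    (inv : ℕ → Carrier) → (∀ k → natR R (suc k) * inv k ≈ 1#) →
    (x y : Carrier) → ¬ (x ≈ 0#) → ¬ (y ≈ 0#) → ¬ (x * x + natR R 4 * y ≈ 0#) →
    (n : ℕ) →
    natR R (suc n) * sumR R ⌊ suc n /2⌋ (λ k →
        natR R (n C (2 *ℕ k +ℕ 1)) * powR R (x * x + natR R 4 * y) (suc k)
          * powR R x (n ∸ (2 *ℕ k +ℕ 1)) * inv k)
      ≈ powR R (natR R 2) (suc n) * lucas R x y (suc n) - natR R 2 * powR R x (suc n)
mainTheorem3 R inv inv-spec x y _ _ _ n = begin
  natR R (suc n) * sumR R M summand
    ≈⟨ *-distribˡ-sumR R M _ summand ⟩
  sumR R M (λ k → natR R (suc n) * summand k)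
    ≈⟨ sumR-cong R M (λ k → [1+n]*oddSummand≈2*evenTerm R x D n k (inv k) (inv-spec k)) ⟩
  sumR R M (λ k → t * tail k)
    ≈⟨ *-distribˡ-sumR R M t tail ⟨
  t * sumR R M tail
    ≈⟨ *-congˡ (sumR-vanishing-tail R tail (ℕ.⌊n/2⌋≤n (suc n)) tail-vanishes) ⟨
  t * sumR R (suc n) tail
    ≈⟨ xyx⁻¹≈y _ _ ⟨
  t * powR R x (suc n) + t * sumR R (suc n) tail - t * powR R x (suc n)
    ≈⟨ +-congʳ (trans (*-congˡ (evenSum-split R x D (suc n))) (distribˡ t _ _)) ⟨
  t * evenSum R x D (suc n) - t * powR R x (suc n)
    ≈⟨ +-congʳ (scaledLucas≈2*evenSum R x y (suc n)) ⟨
  powR R t (suc n) * lucas R x y (suc n) - t * powR R x (suc n)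
    ∎
  where
  open CommutativeRing R
  open import Algebra.Properties.AbelianGroup +-abelianGroup using (xyx⁻¹≈y)
  open import Relation.Binary.Reasoning.Setoid setoid
  t = natR R 2
  D = x * x + natR R 4 * y
  M = ⌊ suc n /2⌋
  summand : ℕ → Carrier
  summand k = natR R (n C (2 *ℕ k +ℕ 1)) * powR R D (suc k) * powR R x (n ∸ (2 *ℕ k +ℕ 1)) * inv k
  tail : ℕ → Carrier
  tail k = evenTerm R x D (suc n) (suc k)
  tail-vanishes : ∀ k → M ≤ k → tail k ≈ 0#
  tail-vanishes k M≤k = evenTerm-vanish R x D (suc n) (suc k)
    (ℕ.<-≤-trans (n<2*[1+⌊n/2⌋] (suc n)) (ℕ.*-monoʳ-≤ 2 (s≤s M≤k)))
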